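{- Let $G$ be a graph and $k$ a positive integer. If $G$ has a RED:LD set of cardinality at most $k$ (i.e. $\textrm{RED:LD}(G) \le k$), then $|V(G)| \le 2^{k-1}+k-2$.
   Context: $N(v)$ denotes the open neighborhood of $v$. A set $S \subseteq V(G)$ is a locating-dominating (LD) set if for all $u,v \in V(G)-S$: $N(v)\cap S \neq \varnothing$, and if $u \ne v$ then $N(v) \cap S \neq N(u) \cap S$. A RED:LD set is an LD set $S$ such that $S-\{v\}$ is an LD set for every $v \in S$. $\textrm{RED:LD}(G)$ denotes the minimum cardinality of a RED:LD set of $G$. -}

module Defs where

open import Data.Nat using (ℕ)
open import Data.Bool using (Bool; true; false)
open import Data.Fin using (Fin)
open import Data.Fin.Subset using (Subset; _∈_; _∉_; ⁅_⁆; _─_)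
open import Data.Product using (∃; _×_)
open import Relation.Binary.PropositionalEquality using (_≡_; _≢_)
open import Relation.Nullary using (¬_)

record Graph : Set where
  field
    n     : ℕ
    adj   : Fin n → Fin n → Bool
    sym   : ∀ u v → adj u v ≡ adj v u
    irrefl : ∀ v → adj v v ≡ false

open Graph public

Adj : (G : Graph) → Fin (n G) → Fin (n G) → Set
Adj G u v = adj G u v ≡ true

-- S is a locating-dominating set of G:
-- every vertex outside S has a neighbour in S, and distinct vertices
-- outside S have distinct sets N(v) ∩ S.
IsLD : (G : Graph) → Subset (n G) → Set
IsLD G S =
  (∀ v → v ∉ S → ∃ λ w → w ∈ S × Adj G v w)
  × (∀ u v → u ∉ S → v ∉ S → u ≢ v →
       ¬ (∀ w → w ∈ S → (Adj G u w → Adj G v w) × (Adj G v w → Adj G u w)))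

IsREDLD : (G : Graph) → Subset (n G) → Set
IsREDLD G S = IsLD G S × (∀ v → v ∈ S → IsLD G (S ─ ⁅ v ⁆))

-- Deleting any vertex x from a RED:LD set S leaves the LD set S − {x}, so a
-- RED:LD set of size at most k yields an LD set T of size at most k − 1. For an
-- LD set T, the traces N(v) ∩ T of the vertices v outside T are pairwise
-- distinct nonempty subsets of T, whence n − |T| ≤ 2^|T| − 1, i.e.
-- n + 1 ≤ 2^|T| + |T|, and this bound is monotone in |T|.
module Submission where

open import Defs hiding (sym)
open import Data.Nat using (ℕ; _≤_; _+_; _∸_; _^_; suc; zero; z≤n; s≤s)
open import Data.Nat.Properties
  using (≤-refl; ≤-trans; ≤-pred; +-suc; +-identityʳ; +-mono-≤; +-monoˡ-≤; ^-monoʳ-≤; m∸n+n≡m; module ≤-Reasoning)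
open import Data.Bool using (Bool; true; false)
open import Data.Bool.Properties using (_≟_)
open import Data.Fin using (Fin) renaming (zero to fzero; suc to fsuc)
open import Data.Fin.Properties using (suc-injective)
open import Data.Fin.Subset using (Subset; ∣_∣; _∈_; _∉_; _⊆_; _∩_; _─_; ⁅_⁆; ∁) renaming (⊥ to ∅)
open import Data.Fin.Subset.Properties
  using (∉⊥; drop-∷-⊆; ⊥⊆; p∩q⊆q; x∈p∩q⁺; x∈p∩q⁻; x∈∁p⇒x∉p; ∣∁p∣≡n∸∣p∣; ∣p∣≤n; ∣⊥∣≡0;
         Empty-unique; nonempty?; x∈p⇒∣p-x∣<∣p∣)
open import Data.Vec using ([]; _∷_; here; there; tabulate)
open import Data.Vec.Properties using ([]=⇒lookup; lookup⇒[]=; lookup∘tabulate)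
open import Data.List using (List; length; map) renaming ([] to []ˡ; _∷_ to _∷ˡ_)
open import Data.List.Properties using (length-map)
open import Data.List.Relation.Unary.All as All using (All) renaming ([] to []ᵃ; _∷_ to _∷ᵃ_)
import Data.List.Relation.Unary.All.Properties as All
open import Data.List.Relation.Unary.AllPairs using () renaming ([] to []ᵖ; _∷_ to _∷ᵖ_)
open import Data.List.Relation.Unary.Unique.Propositional using (Unique)
import Data.List.Relation.Unary.Unique.Propositional.Properties as Unique
open import Data.Product using (∃; _×_; _,_; proj₁; proj₂)
open import Function using (_∘_)
open import Relation.Nullary using (yes; no; contradiction)
open import Relation.Binary.PropositionalEquality using (_≡_; _≢_; refl; sym; trans; cong; subst)

private
  variable
    A B : Set
    m k : ℕ
    b c : Bool
    x : Subset m

unique-map⁺ : {P : A → Set} {f : A → B} {xs : List A} →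
  (∀ {x y} → P x → P y → x ≢ y → f x ≢ f y) → All P xs → Unique xs → Unique (map f xs)
unique-map⁺ inj []ᵃ []ᵖ = []ᵖ
unique-map⁺ inj (px ∷ᵃ pxs) (x≢xs ∷ᵖ u) =
  All.map⁺ (All.zipWith (λ (py , x≢y) → inj px py x≢y) (pxs , x≢xs)) ∷ᵖ unique-map⁺ inj pxs u

elements : Subset m → List (Fin m)
elements []          = []ˡ
elements (true ∷ s)  = fzero ∷ˡ map fsuc (elements s)
elements (false ∷ s) = map fsuc (elements s)

length-elements : (s : Subset m) → length (elements s) ≡ ∣ s ∣
length-elements []          = refl
length-elements (true ∷ s)  = cong suc (trans (length-map fsuc (elements s)) (length-elements s))
length-elements (false ∷ s) = trans (length-map fsuc (elements s)) (length-elements s)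

elements-∈ : (s : Subset m) → All (_∈ s) (elements s)
elements-∈ []          = []ᵃ
elements-∈ (true ∷ s)  = here ∷ᵃ All.map⁺ (All.map there (elements-∈ s))
elements-∈ (false ∷ s) = All.map⁺ (All.map there (elements-∈ s))

elements-unique : (s : Subset m) → Unique (elements s)
elements-unique []          = []ᵖ
elements-unique (true ∷ s)  =
  All.map⁺ (All.universal (λ _ ()) (elements s)) ∷ᵖ Unique.map⁺ suc-injective (elements-unique s)
elements-unique (false ∷ s) = Unique.map⁺ suc-injective (elements-unique s)

withHead : Bool → List (Subset (suc m)) → List (Subset m)
withHead b []ˡ            = []ˡ
withHead b ((c ∷ x) ∷ˡ xs) with b ≟ c
... | yes _ = x ∷ˡ withHead b xs
... | no _  = withHead b xs

length-withHead : (xs : List (Subset (suc m))) →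
  length xs ≡ length (withHead true xs) + length (withHead false xs)
length-withHead []ˡ                 = refl
length-withHead ((true ∷ x) ∷ˡ xs)  = cong suc (length-withHead xs)
length-withHead ((false ∷ x) ∷ˡ xs) = trans (cong suc (length-withHead xs)) (sym (+-suc _ _))

withHead-≢ : {xs : List (Subset (suc m))} → All ((b ∷ x) ≢_) xs → All (x ≢_) (withHead b xs)
withHead-≢ {xs = []ˡ} []ᵃ = []ᵃ
withHead-≢ {b = b} {xs = (c ∷ y) ∷ˡ xs} (bx≢cy ∷ᵃ h) with b ≟ c
... | yes refl = (bx≢cy ∘ cong (b ∷_)) ∷ᵃ withHead-≢ h
... | no _     = withHead-≢ h

withHead-unique : {xs : List (Subset (suc m))} → Unique xs → Unique (withHead b xs)
withHead-unique {xs = []ˡ} []ᵖ = []ᵖ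
withHead-unique {b = b} {xs = (c ∷ x) ∷ˡ xs} (cx≢xs ∷ᵖ u) with b ≟ c
... | yes refl = withHead-≢ cx≢xs ∷ᵖ withHead-unique u
... | no _     = withHead-unique u

withHead-⊆ : {p : Subset m} {xs : List (Subset (suc m))} →
  All (_⊆ c ∷ p) xs → All (_⊆ p) (withHead b xs)
withHead-⊆ {xs = []ˡ} []ᵃ = []ᵃ
withHead-⊆ {b = b} {xs = (d ∷ x) ∷ˡ xs} (dx⊆ ∷ᵃ h) with b ≟ d
... | yes _ = drop-∷-⊆ dx⊆ ∷ᵃ withHead-⊆ h
... | no _  = withHead-⊆ h

withHead-true-≡[] : {p : Subset m} {xs : List (Subset (suc m))} →
  All (_⊆ false ∷ p) xs → withHead true xs ≡ []ˡ
withHead-true-≡[] {xs = []ˡ} []ᵃ = refl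
withHead-true-≡[] {xs = (true ∷ x) ∷ˡ xs} (tx⊆ ∷ᵃ _) = contradiction (tx⊆ here) λ ()
withHead-true-≡[] {xs = (false ∷ x) ∷ˡ xs} (_ ∷ᵃ h) = withHead-true-≡[] h

length≤2^∣p∣ : (p : Subset m) {xs : List (Subset m)} → Unique xs → All (_⊆ p) xs → length xs ≤ 2 ^ ∣ p ∣
length≤2^∣p∣ [] {[]ˡ}                 _                 _ = z≤n
length≤2^∣p∣ [] {[] ∷ˡ []ˡ}           _                 _ = ≤-refl
length≤2^∣p∣ [] {[] ∷ˡ [] ∷ˡ _}       ((≢[] ∷ᵃ _) ∷ᵖ _) _ = contradiction refl ≢[]
length≤2^∣p∣ (true ∷ p) {xs} u xs⊆ = begin
  length xs                                              ≡⟨ length-withHead xs ⟩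
  length (withHead true xs) + length (withHead false xs) ≤⟨ +-mono-≤ (part true) (part false) ⟩
  2 ^ ∣ p ∣ + 2 ^ ∣ p ∣                                  ≡⟨ cong (2 ^ ∣ p ∣ +_) (sym (+-identityʳ _)) ⟩
  2 ^ suc ∣ p ∣                                          ∎
  where
  open ≤-Reasoning
  part : ∀ b → length (withHead b xs) ≤ 2 ^ ∣ p ∣
  part b = length≤2^∣p∣ p (withHead-unique u) (withHead-⊆ xs⊆)
length≤2^∣p∣ (false ∷ p) {xs} u xs⊆ = begin
  length xs                                              ≡⟨ length-withHead xs ⟩
  length (withHead true xs) + length (withHead false xs) ≡⟨ cong (λ ys → length ys + length (withHead false xs)) (withHead-true-≡[] xs⊆) ⟩
  length (withHead false xs)                             ≤⟨ length≤2^∣p∣ p (withHead-unique u) (withHead-⊆ xs⊆) ⟩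
  2 ^ ∣ p ∣                                              ∎
  where open ≤-Reasoning

module _ (G : Graph) where

  private
    variable
      u v w : Fin (n G)
      S : Subset (n G)

  neighbourhood : Fin (n G) → Subset (n G)
  neighbourhood v = tabulate (adj G v)

  trace : Subset (n G) → Fin (n G) → Subset (n G)
  trace S v = neighbourhood v ∩ S

  ∈-trace⁺ : Adj G v w → w ∈ S → w ∈ trace S v
  ∈-trace⁺ {v} {w} vw w∈S = x∈p∩q⁺ (lookup⇒[]= w _ (trans (lookup∘tabulate (adj G v) w) vw) , w∈S)

  ∈-trace⁻ : w ∈ trace S v → Adj G v w
  ∈-trace⁻ {w} {S} {v} w∈ with x∈p∩q⁻ (neighbourhood v) S w∈
  ... | w∈N , _ = trans (sym (lookup∘tabulate (adj G v) w)) ([]=⇒lookup w∈N)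

  trace-≡⇒same-neighbours : trace S u ≡ trace S v →
    ∀ w → w ∈ S → (Adj G u w → Adj G v w) × (Adj G v w → Adj G u w)
  trace-≡⇒same-neighbours tu≡tv w w∈S =
    (λ uw → ∈-trace⁻ (subst (w ∈_) tu≡tv (∈-trace⁺ uw w∈S))) ,
    (λ vw → ∈-trace⁻ (subst (w ∈_) (sym tu≡tv) (∈-trace⁺ vw w∈S)))

  module _ {S : Subset (n G)} (ld : IsLD G S) where

    trace-nonempty : v ∉ S → ∅ ≢ trace S v
    trace-nonempty v∉S ∅≡tv with proj₁ ld _ v∉S
    ... | w , w∈S , vw = contradiction (subst (w ∈_) (sym ∅≡tv) (∈-trace⁺ vw w∈S)) ∉⊥

    trace-injective : u ∉ S → v ∉ S → u ≢ v → trace S u ≢ trace S v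
    trace-injective u∉S v∉S u≢v tu≡tv = proj₂ ld _ _ u∉S v∉S u≢v (trace-≡⇒same-neighbours tu≡tv)

    n+1≤2^∣S∣+∣S∣ : n G + 1 ≤ 2 ^ ∣ S ∣ + ∣ S ∣
    n+1≤2^∣S∣+∣S∣ = begin
      n G + 1                   ≡⟨ +-suc (n G) 0 ⟩
      suc (n G + 0)             ≡⟨ cong suc (+-identityʳ (n G)) ⟩
      suc (n G)                 ≡⟨ cong suc (sym (m∸n+n≡m (∣p∣≤n S))) ⟩
      suc (n G ∸ ∣ S ∣) + ∣ S ∣ ≤⟨ +-monoˡ-≤ ∣ S ∣ outside-count ⟩
      2 ^ ∣ S ∣ + ∣ S ∣         ∎
      where
      open ≤-Reasoning
      outside : List (Fin (n G))
      outside = elements (∁ S)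

      outside-∉ : All (_∉ S) outside
      outside-∉ = All.map x∈∁p⇒x∉p (elements-∈ (∁ S))

      traces : List (Subset (n G))
      traces = ∅ ∷ˡ map (trace S) outside

      traces-unique : Unique traces
      traces-unique =
        All.map⁺ (All.map trace-nonempty outside-∉)
        ∷ᵖ unique-map⁺ trace-injective outside-∉ (elements-unique (∁ S))

      traces-⊆ : All (_⊆ S) traces
      traces-⊆ = ⊥⊆ ∷ᵃ All.map⁺ (All.universal (λ v {_} → p∩q⊆q (neighbourhood v) S) outside)

      length-traces : length traces ≡ suc (n G ∸ ∣ S ∣)
      length-traces = cong suc (trans (length-map (trace S) outside)
                                (trans (length-elements (∁ S)) (∣∁p∣≡n∸∣p∣ S)))

      outside-count : suc (n G ∸ ∣ S ∣) ≤ 2 ^ ∣ S ∣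
      outside-count = subst (_≤ 2 ^ ∣ S ∣) length-traces (length≤2^∣p∣ S traces-unique traces-⊆)

  IsREDLD⇒smaller-IsLD : {S : Subset (n G)} → IsREDLD G S → ∣ S ∣ ≤ suc k →
    ∃ λ T → IsLD G T × ∣ T ∣ ≤ k
  IsREDLD⇒smaller-IsLD {k} {S} (ld , red) ∣S∣≤ with nonempty? S
  ... | yes (x , x∈S) = S ─ ⁅ x ⁆ , red x x∈S , ≤-pred (≤-trans (x∈p⇒∣p-x∣<∣p∣ x∈S) ∣S∣≤)
  ... | no S-empty    = S , ld , subst (_≤ k) (sym ∣S∣≡0) z≤n
    where
    ∣S∣≡0 : ∣ S ∣ ≡ 0
    ∣S∣≡0 = trans (cong ∣_∣ (Empty-unique S-empty)) (∣⊥∣≡0 (n G))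

theorem3 : (G : Graph) → (k : ℕ) → 1 ≤ k →
    (∃ λ (S : Subset (n G)) → IsREDLD G S × ∣ S ∣ ≤ k) →
    n G + 2 ≤ 2 ^ (k ∸ 1) + k
theorem3 G zero () _
theorem3 G (suc k) _ (S , redld , ∣S∣≤) with IsREDLD⇒smaller-IsLD G redld ∣S∣≤
... | T , ld , ∣T∣≤k = begin
  n G + 2                 ≡⟨ +-suc (n G) 1 ⟩
  suc (n G + 1)           ≤⟨ s≤s (n+1≤2^∣S∣+∣S∣ G ld) ⟩
  suc (2 ^ ∣ T ∣ + ∣ T ∣) ≤⟨ s≤s (+-mono-≤ (^-monoʳ-≤ 2 ∣T∣≤k) ∣T∣≤k) ⟩
  suc (2 ^ k + k)         ≡⟨ sym (+-suc (2 ^ k) k) ⟩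
  2 ^ k + suc k           ∎
  where open ≤-Reasoning
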